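{- Let $n\ge 3$ and $j\ge 1$ be integers. If $k$ is a positive integer such that $nk$ is even, then $(1,(n^{j}-1)^{nk}-1,(n^{j}-1)^{nk})$ is an $abc$ triple.
   Context: For a positive integer $n$, $\operatorname{rad}(n)$ denotes the product of the distinct prime factors of $n$. An $abc$ triple is a triple $(a,b,c)$ of relatively prime positive integers with $a+b=c$ and $\operatorname{rad}(abc)<c$. -}

module Defs where

open import Data.Nat using (ℕ; zero; suc; _+_; _*_; _<_)
open import Data.Nat.Divisibility using (_∣_; _∣?_)
open import Data.Nat.Primality using (Prime; prime?)
open import Data.Nat.Coprimality using (Coprime)
open import Data.List using (List; filter; upTo)
open import Data.Nat.ListAction using (product)
open import Relation.Binary.PropositionalEquality using (_≡_)
open import Data.Product using (_×_)
open import Relation.Nullary.Decidable using (_×-dec_)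

-- The primes dividing n (for n ≥ 1) all lie in [0, n], so we take the
-- product of all p ∈ {0,…,n} with p prime and p ∣ n.  (rad 0 is not used.)
rad : ℕ → ℕ
rad n = product (filter (λ p → prime? p ×-dec (p ∣? n)) (upTo (suc n)))

-- (a , b , c) is an abc triple: positive, relatively prime
-- (gcd(a,b)=1, which with a + b = c is equivalent to pairwise coprimality,
-- but we require all three pairs explicitly), a + b = c, rad(abc) < c.
IsAbcTriple : ℕ → ℕ → ℕ → Set
IsAbcTriple a b c =
  (0 < a) × (0 < b) × (0 < c) ×
  Coprime a b × Coprime a c × Coprime b c ×
  (a + b ≡ c) × (rad (a * b * c) < c)

-- Put a = n^j − 1 and c = a^(nk) with nk = 2q. Since a² = 1 + (a + 1)(a − 1),
-- expanding (1 + (a + 1)(a − 1))^q gives c − 1 = (a + 1)·m with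
-- m = (a − 1)(q + (a + 1)r). As n divides both a + 1 = n^j and 2q, it divides
-- (a − 1)q = (a + 1)q − 2q and hence m. So every prime factor of (a + 1)·m
-- already divides m, every prime factor of c divides a, and
-- rad(c(c − 1)) ≤ a·m < (a + 1)·m < c.
module Submission where

open import Defs

open import Data.Nat
open import Data.Nat.Properties
open import Data.Nat.Divisibility
open import Data.Nat.Primality
open import Data.Nat.Primality.Factorisation using (factorisationHasAllPrimeFactors)
open import Data.Nat.Coprimality as Coprimality using (Coprime; coprime-divisor; coprime-+; 1-coprimeTo)
open import Data.Nat.ListAction using (product)
open import Data.Nat.Tactic.RingSolver using (solve-∀)
open import Data.List using ([]; _∷_; filter; upTo)
open import Data.List.Membership.Propositional using (_∉_)
open import Data.List.Relation.Unary.All as All using (All; _∷_)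
open import Data.List.Relation.Unary.All.Properties using (all-filter)
open import Data.List.Relation.Unary.AllPairs using (_∷_)
open import Data.List.Relation.Unary.Unique.Propositional using (Unique)
open import Data.List.Relation.Unary.Unique.Propositional.Properties using (upTo⁺; filter⁺)
open import Data.Product using (∃-syntax; _,_; proj₁)
open import Data.Sum using (inj₁; inj₂; [_,_]′)
open import Relation.Binary.PropositionalEquality
open import Relation.Nullary using (contradiction)
open import Relation.Nullary.Decidable using (_×-dec_)

prime∉⇒coprime-product : ∀ {p ps} → Prime p → All Prime ps → p ∉ ps → Coprime p (product ps)
prime∉⇒coprime-product pp pps p∉ps (d∣p , d∣product) with prime⇒irreducible pp d∣p
... | inj₁ d≡1  = d≡1
... | inj₂ refl = contradiction (factorisationHasAllPrimeFactors pp d∣product pps) p∉ps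

distinctPrimes⇒product∣ : ∀ {ps y} → Unique ps → All Prime ps → All (_∣ y) ps → product ps ∣ y
distinctPrimes⇒product∣ {[]}     _ _ _ = 1∣ _
distinctPrimes⇒product∣ {p ∷ ps} (p≢ps ∷ unique) (pp ∷ pps) (p∣y ∷ ps∣y)
  with distinctPrimes⇒product∣ unique pps ps∣y
... | divides r y≡r*P = subst (p * product ps ∣_) (sym y≡r*P) (*-monoˡ-∣ (product ps) p∣r)
  where
  p∣r : p ∣ r
  p∣r = coprime-divisor (prime∉⇒coprime-product pp pps (λ p∈ps → All.lookup p≢ps p∈ps refl))
          (subst (p ∣_) (trans y≡r*P (*-comm r (product ps))) p∣y)

rad∣ : ∀ {x y} → (∀ {p} → Prime p → p ∣ x → p ∣ y) → rad x ∣ y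
rad∣ {x} primeFactors∣y =
  distinctPrimes⇒product∣ (filter⁺ P? (upTo⁺ (suc x)))
    (All.map proj₁ chosen) (All.map (λ (pp , p∣x) → primeFactors∣y pp p∣x) chosen)
  where
  P? = λ p → prime? p ×-dec (p ∣? x)
  chosen = all-filter P? (upTo (suc x))

prime∣^⇒∣ : ∀ {p} a e → Prime p → p ∣ a ^ e → p ∣ a
prime∣^⇒∣ a zero    pp p∣1 = contradiction (∣1⇒≡1 p∣1) (nonTrivial⇒≢1 {{prime⇒nonTrivial pp}})
prime∣^⇒∣ a (suc e) pp p∣a*aᵉ = [ (λ p∣a → p∣a) , prime∣^⇒∣ a e pp ]′ (euclidsLemma a (a ^ e) pp p∣a*aᵉ)

-- Here rad(c(c − 1)) divides a·m, where c = 1 + u·m.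
isAbcTriple-1+ : ∀ {a u m} → a ≤ u → 0 < a → 0 < m →
  (∀ {p} → Prime p → p ∣ u → p ∣ m) → (∀ {p} → Prime p → p ∣ 1 + u * m → p ∣ a) →
  IsAbcTriple 1 (u * m) (1 + u * m)
isAbcTriple-1+ {a} {u} {m} a≤u 0<a 0<m primes-u primes-c =
  z<s , 0<b , z<s , 1-coprimeTo b , 1-coprimeTo (1 + b) , coprime-b-1+b , refl , rad<c
  where
  b = u * m
  0<b : 0 < b
  0<b = *-mono-≤ (≤-trans 0<a a≤u) 0<m
  coprime-b-1+b : Coprime b (1 + b)
  coprime-b-1+b = Coprimality.sym (subst (λ x → Coprime x b) (+-comm b 1) (coprime-+ (1-coprimeTo b)))
  primes∣a*m : ∀ {p} → Prime p → p ∣ 1 * b * (1 + b) → p ∣ a * m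
  primes∣a*m {p} pp p∣abc with euclidsLemma (1 * b) (1 + b) pp p∣abc
  ... | inj₂ p∣c = ∣m⇒∣m*n m (primes-c pp p∣c)
  ... | inj₁ p∣b = [ (λ p∣u → ∣n⇒∣m*n a (primes-u pp p∣u)) , ∣n⇒∣m*n a ]′
                     (euclidsLemma u m pp (subst (p ∣_) (*-identityˡ b) p∣b))
  rad<c : rad (1 * b * (1 + b)) < 1 + b
  rad<c = s≤s (begin
    rad (1 * b * (1 + b)) ≤⟨ ∣⇒≤ {{>-nonZero (*-mono-≤ 0<a 0<m)}} (rad∣ primes∣a*m) ⟩
    a * m                 ≤⟨ *-monoˡ-≤ m a≤u ⟩
    b                     ∎)
    where open ≤-Reasoning

[1+u*v]^q≡1+u*[v*[q+u*r]] : ∀ u v q → ∃[ r ] (1 + u * v) ^ q ≡ 1 + u * (v * (q + u * r))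
[1+u*v]^q≡1+u*[v*[q+u*r]] u v zero = 0 , base u v
  where
  base : ∀ u v → 1 ≡ 1 + u * (v * (0 + u * 0))
  base = solve-∀
[1+u*v]^q≡1+u*[v*[q+u*r]] u v (suc q) with [1+u*v]^q≡1+u*[v*[q+u*r]] u v q
... | r , eq = r + v * (q + u * r) , (begin
  (1 + u * v) * (1 + u * v) ^ q                 ≡⟨ cong ((1 + u * v) *_) eq ⟩
  (1 + u * v) * (1 + u * (v * (q + u * r)))     ≡⟨ step u v q r ⟩
  1 + u * (v * (suc q + u * (r + v * (q + u * r)))) ∎)
  where
  open ≡-Reasoning
  step : ∀ u v q r → (1 + u * v) * (1 + u * (v * (q + u * r)))
                   ≡ 1 + u * (v * (suc q + u * (r + v * (q + u * r))))
  step = solve-∀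

[1+t]^[q*2]≡1+[2+t]*[t*[q+[2+t]*r]] : ∀ t q → ∃[ r ] (1 + t) ^ (q * 2) ≡ 1 + (2 + t) * (t * (q + (2 + t) * r))
[1+t]^[q*2]≡1+[2+t]*[t*[q+[2+t]*r]] t q with [1+u*v]^q≡1+u*[v*[q+u*r]] (2 + t) t q
... | r , eq = r , (begin
  (1 + t) ^ (q * 2)     ≡⟨ cong ((1 + t) ^_) (*-comm q 2) ⟩
  (1 + t) ^ (2 * q)     ≡⟨ ^-*-assoc (1 + t) 2 q ⟨
  ((1 + t) ^ 2) ^ q     ≡⟨ cong (_^ q) (square t) ⟩
  (1 + (2 + t) * t) ^ q ≡⟨ eq ⟩
  1 + (2 + t) * (t * (q + (2 + t) * r)) ∎)
  where
  open ≡-Reasoning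
  square : ∀ t → (1 + t) * ((1 + t) * 1) ≡ 1 + (2 + t) * t
  square = solve-∀

-- t stands for a − 1 in the notation above.
isAbcTriple-[1+t]^[q*2] : ∀ {n} t q → 1 ≤ t → 1 ≤ q → n ∣ 2 + t →
  (∀ {p} → Prime p → p ∣ 2 + t → p ∣ n) → n ∣ q * 2 →
  IsAbcTriple 1 ((1 + t) ^ (q * 2) ∸ 1) ((1 + t) ^ (q * 2))
isAbcTriple-[1+t]^[q*2] {n} t q 1≤t 1≤q n∣u primes-u n∣2q
  with [1+t]^[q*2]≡1+[2+t]*[t*[q+[2+t]*r]] t q
... | r , c≡1+u*m =
  subst (λ c → IsAbcTriple 1 (c ∸ 1) c) (sym c≡1+u*m)
    (isAbcTriple-1+ (n≤1+n (1 + t)) z<s 0<m (λ pp p∣u → ∣-trans (primes-u pp p∣u) n∣m) primes-c)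
  where
  m = t * (q + (2 + t) * r)
  0<m : 0 < m
  0<m = *-mono-≤ 1≤t (≤-trans 1≤q (m≤m+n q _))
  n∣t*q : n ∣ t * q
  n∣t*q = ∣m+n∣m⇒∣n (subst (n ∣_) u*q≡q*2+t*q (∣-trans n∣u (m∣m*n q))) n∣2q
    where
    u*q≡q*2+t*q : (2 + t) * q ≡ q * 2 + t * q
    u*q≡q*2+t*q = trans (*-distribʳ-+ q 2 t) (cong (_+ t * q) (*-comm 2 q))
  n∣m : n ∣ m
  n∣m = subst (n ∣_) (sym (*-distribˡ-+ t q _))
          (∣m∣n⇒∣m+n n∣t*q (∣n⇒∣m*n t (∣-trans n∣u (m∣m*n r))))
  primes-c : ∀ {p} → Prime p → p ∣ 1 + (2 + t) * m → p ∣ 1 + t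
  primes-c {p} pp p∣c = prime∣^⇒∣ (1 + t) (q * 2) pp (subst (p ∣_) (sym c≡1+u*m) p∣c)

corollary3p10 : (n j k : ℕ) → 3 ≤ n → 1 ≤ j → 1 ≤ k → 2 ∣ n * k →
    IsAbcTriple 1 ((n ^ j ∸ 1) ^ (n * k) ∸ 1) ((n ^ j ∸ 1) ^ (n * k))
corollary3p10 n j@(suc j′) k 3≤n _ 1≤k (divides q n*k≡q*2) =
  subst (λ c → IsAbcTriple 1 (c ∸ 1) c) (cong₂ _^_ (sym nʲ∸1≡1+t) (sym n*k≡q*2))
    (isAbcTriple-[1+t]^[q*2] t q 1≤t 1≤q
      (subst (n ∣_) nʲ≡2+t (m∣m*n (n ^ j′)))
      (λ {p} pp p∣u → prime∣^⇒∣ n j pp (subst (p ∣_) (sym nʲ≡2+t) p∣u))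
      (subst (n ∣_) n*k≡q*2 (m∣m*n k)))
  where
  t = n ^ j ∸ 2
  3≤nʲ : 3 ≤ n ^ j
  3≤nʲ = ≤-trans 3≤n (subst (_≤ n ^ j) (*-identityʳ n)
           (^-monoʳ-≤ n {{>-nonZero (≤-trans z<s 3≤n)}} {1} {j} (s≤s z≤n)))
  nʲ≡2+t : n ^ j ≡ 2 + t
  nʲ≡2+t = sym (m+[n∸m]≡n (≤-trans (n≤1+n 2) 3≤nʲ))
  nʲ∸1≡1+t : n ^ j ∸ 1 ≡ 1 + t
  nʲ∸1≡1+t = cong (_∸ 1) nʲ≡2+t
  1≤t : 1 ≤ t
  1≤t = ∸-monoˡ-≤ 2 3≤nʲ
  1≤q : 1 ≤ q
  1≤q = half-positive q (*-mono-≤ (≤-trans z<s 3≤n) 1≤k) n*k≡q*2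
    where
    half-positive : ∀ {x} y → 0 < x → x ≡ y * 2 → 0 < y
    half-positive zero    0<x x≡0 = contradiction x≡0 (>⇒≢ 0<x)
    half-positive (suc _) _   _   = z<s
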